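{- Let $q\ge 4$ be a prime power, let $E$ be the set of points of $\mathbb{P}^2(\mathbb{F}_q)$ (the coordinate set of the Veronese code $C_q$), and let $M_q$ be the parity check matroid of $C_q$ with nullity function $n$. Then for every $X\subseteq E$, $n(X)$ equals the dimension over $\mathbb{F}_q$ of the vector space of homogeneous quadratic polynomials in $x,y,z$ over $\mathbb{F}_q$ (the polynomial expressions defining conics) that vanish at all points of $E\setminus X$.
   Context: Let $q$ be a prime power. Fix an ordering of the $q^2+q+1$ points of $\mathbb{P}^2$ over $\mathbb{F}_q$ and a coordinate representative $(x,y,z)$ of each; identify the coordinate positions $\{1,\dots,q^2+q+1\}$ with the set $E$ of these points. The Veronese code $C_q$ is the linear $[q^2+q+1,6]_q$ code with generator matrix whose columns are $(x^2,xy,xz,y^2,yz,z^2)$ for the chosen representatives. The parity check matroid $M_q$ of $C_q$ is the matroid on $E$ whose independent sets are the subsets $X$ such that the columns of a parity check matrix of $C_q$ indexed by $X$ are linearly independent over $\mathbb{F}_q$ (this does not depend on the parity check matrix). For $X\subseteq E$, $r(X)$ is the maximum size of an independent subset of $X$, and the nullity is $n(X)=|X|-r(X)$. -}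

module Defs where

open import Level using (0ℓ)
open import Algebra.Bundles using (CommutativeRing)
open import Data.Nat using (ℕ; zero; suc; _∸_; _^_; _≤_)
import Data.Nat as ℕ
open import Data.Nat.Primality using (Prime)
open import Data.Fin using (Fin)
import Data.Fin as Fin
open import Data.Fin.Subset using (Subset; _∈_; _∉_; _⊆_; ∣_∣)
open import Data.Product using (Σ; ∃; _×_; _,_)
open import Relation.Nullary using (¬_)
open import Relation.Binary.PropositionalEquality using (_≡_)

IsPrimePower : ℕ → Set
IsPrimePower q = Σ ℕ λ p → Σ ℕ λ k → Prime p × 1 ≤ k × q ≡ p ^ k

-- Number of points of the projective plane over a field with q elements
numPoints : ℕ → ℕ
numPoints q = q ℕ.* q ℕ.+ q ℕ.+ 1

module _ (R : CommutativeRing 0ℓ 0ℓ) where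
  open CommutativeRing R

  IsField : Set
  IsField = (¬ 0# ≈ 1#) × (∀ x → ¬ x ≈ 0# → ∃ λ y → x * y ≈ 1#)

  HasSize : ℕ → Set
  HasSize q = Σ (Fin q → Carrier) λ f →
    (∀ i j → f i ≈ f j → i ≡ j) × (∀ x → ∃ λ i → f i ≈ x)

  ∑ : ∀ {n} → (Fin n → Carrier) → Carrier
  ∑ {zero}  f = 0#
  ∑ {suc n} f = f Fin.zero + ∑ (λ i → f (Fin.suc i))

  F³ : Set
  F³ = Fin 3 → Carrier

  x₀ y₀ z₀ : F³ → Carrier
  x₀ v = v Fin.zero
  y₀ v = v (Fin.suc Fin.zero)
  z₀ v = v (Fin.suc (Fin.suc Fin.zero))

  _∼_ : F³ → F³ → Set
  u ∼ v = ∃ λ (c : Carrier) → ∀ i → u i ≈ c * v i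

  NonZero³ : F³ → Set
  NonZero³ v = ¬ (∀ i → v i ≈ 0#)

  -- rep : Fin N → F³ is a list of representatives of all points of P²(F),
  -- each point occurring exactly once.
  IsPointList : ∀ {N} → (Fin N → F³) → Set
  IsPointList {N} rep =
    (∀ p → NonZero³ (rep p)) ×
    (∀ p p′ → rep p ∼ rep p′ → p ≡ p′) ×
    (∀ v → NonZero³ v → ∃ λ p → v ∼ rep p)

  monomial : Fin 6 → F³ → Carrier
  monomial Fin.zero v = x₀ v * x₀ v
  monomial (Fin.suc Fin.zero) v = x₀ v * y₀ v
  monomial (Fin.suc (Fin.suc Fin.zero)) v = x₀ v * z₀ v
  monomial (Fin.suc (Fin.suc (Fin.suc Fin.zero))) v = y₀ v * y₀ v
  monomial (Fin.suc (Fin.suc (Fin.suc (Fin.suc Fin.zero)))) v = y₀ v * z₀ v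
  monomial (Fin.suc (Fin.suc (Fin.suc (Fin.suc (Fin.suc Fin.zero))))) v = z₀ v * z₀ v

  veroneseGen : ∀ {N} → (Fin N → F³) → Fin 6 → Fin N → Carrier
  veroneseGen rep k p = monomial k (rep p)

  InCode : ∀ {k N} → (Fin k → Fin N → Carrier) → (Fin N → Carrier) → Set
  InCode G v = ∃ λ (u : Fin _ → Carrier) → ∀ p → v p ≈ ∑ (λ i → u i * G i p)

  IsParityCheck : ∀ {k N} → (Fin k → Fin N → Carrier) →
                  (Fin (N ∸ k) → Fin N → Carrier) → Set
  IsParityCheck G H = ∀ v →
    ((∀ j → ∑ (λ p → H j p * v p) ≈ 0#) → InCode G v) ×
    (InCode G v → ∀ j → ∑ (λ p → H j p * v p) ≈ 0#)

  ColIndep : ∀ {m N} → (Fin m → Fin N → Carrier) → Subset N → Set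
  ColIndep A Y = ∀ (c : Fin _ → Carrier) →
    (∀ p → p ∉ Y → c p ≈ 0#) →
    (∀ j → ∑ (λ p → c p * A j p) ≈ 0#) →
    ∀ p → c p ≈ 0#

  IsRank : ∀ {m N} → (Fin m → Fin N → Carrier) → Subset N → ℕ → Set
  IsRank A X r =
    (∃ λ Y → Y ⊆ X × ColIndep A Y × ∣ Y ∣ ≡ r) ×
    (∀ Y → Y ⊆ X → ColIndep A Y → ∣ Y ∣ ≤ r)

  IsNullity : ∀ {m N} → (Fin m → Fin N → Carrier) → Subset N → ℕ → Set
  IsNullity A X n = ∃ λ r → IsRank A X r × n ≡ ∣ X ∣ ∸ r

  -- a quadratic form (homogeneous quadratic polynomial in x,y,z) as its
  -- coefficient vector w.r.t. the monomials x², xy, xz, y², yz, z²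
  Quadric : Set
  Quadric = Fin 6 → Carrier

  evalQ : Quadric → F³ → Carrier
  evalQ f v = ∑ (λ k → f k * monomial k v)

  QIndep : ∀ {d} → (Fin d → Quadric) → Set
  QIndep w = ∀ (a : Fin _ → Carrier) →
    (∀ k → ∑ (λ i → a i * w i k) ≈ 0#) → ∀ i → a i ≈ 0#

  VanishOffX : ∀ {N} → (Fin N → F³) → Subset N → Quadric → Set
  VanishOffX rep X f = ∀ p → p ∉ X → evalQ f (rep p) ≈ 0#

  IsDim : (Quadric → Set) → ℕ → Set
  IsDim V d =
    (∃ λ (w : Fin d → Quadric) → (∀ i → V (w i)) × QIndep w) ×
    (∀ e (w : Fin e → Quadric) → (∀ i → V (w i)) → QIndep w → e ≤ d)

-- Evaluation at the points of P²(F) maps quadratic forms onto the code C = ker H, injectively because a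
-- form vanishing at every point of P² is zero. The forms vanishing off X therefore correspond to the
-- vectors of ker H supported in X, and their dimension is the nullity of X: for a maximal independent
-- Y ⊆ X, each p ∈ X ─ Y gives a dependency supported in Y ∪ {p} that is nonzero at p, these |X ─ Y|
-- vectors are independent, and conversely a vector of ker H supported in X that vanishes on X ─ Y is
-- zero because Y is independent. Since F is finite, dependence is decidable, so the dependencies can
-- be found constructively.
module Submission where

open import Defs
open import Level using (0ℓ)
open import Algebra.Bundles using (CommutativeRing)
import Algebra.Properties.Semiring.Sum
open import Data.Nat using (ℕ; zero; suc; _≤_; z≤n; s≤s)
import Data.Nat as ℕ
open import Data.Nat.Properties using (m≤n⇒m≤1+n)
open import Data.Fin using (Fin; zero; suc; #_; _≟_; punchIn; finToFun; funToFin)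
open import Data.Fin.Properties using (any?; all?; punchInᵢ≢i; finToFun-funToFin)
open import Data.Fin.Subset using (Subset; inside; outside; _∈_; _∉_; ∣_∣; _∪_; ⁅_⁆)
open import Data.Fin.Subset.Properties using (_∈?_; x∈p∪q⁻; x∈⁅y⁆⇒x≡y)
open import Data.Vec using (_∷_; []; here; there)
open import Data.Vec.Functional using (insertAt)
open import Data.Vec.Functional.Properties using (insertAt-punchIn; insertAt-lookup)
open import Data.Product using (∃; _×_; _,_; proj₁; proj₂)
open import Data.Empty using (⊥-elim)
open import Data.Sum using ([_,_])
open import Function using (_∘_)
open import Relation.Nullary using (¬_; Dec; yes; no; ¬?)
open import Relation.Nullary.Decidable using (map′; decidable-stable; _×-dec_; _→-dec_)
open import Relation.Binary.Definitions using (Decidable)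
open import Relation.Binary.PropositionalEquality as ≡ using (_≡_; _≢_)

module SubsetLemmas where
  open import Data.Fin.Properties using (suc-injective)
  open import Data.Fin.Subset using (_⊆_; _─_)
  open import Data.Fin.Subset.Properties using (drop-∷-⊆)
  open import Data.Nat.Properties using (+-suc)

  members : ∀ {N} (S : Subset N) → Fin ∣ S ∣ → Fin N
  members (inside  ∷ S) zero    = zero
  members (inside  ∷ S) (suc k) = suc (members S k)
  members (outside ∷ S) k       = suc (members S k)

  members-∈ : ∀ {N} (S : Subset N) k → members S k ∈ S
  members-∈ (inside  ∷ S) zero    = here
  members-∈ (inside  ∷ S) (suc k) = there (members-∈ S k)
  members-∈ (outside ∷ S) k       = there (members-∈ S k)

  members-injective : ∀ {N} (S : Subset N) {k k′} → members S k ≡ members S k′ → k ≡ k′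
  members-injective (inside  ∷ S) {zero}  {zero}   _  = ≡.refl
  members-injective (inside  ∷ S) {suc k} {suc k′} eq = ≡.cong suc (members-injective S (suc-injective eq))
  members-injective (outside ∷ S)                  eq = members-injective S (suc-injective eq)

  x∈p─q⇒x∉q : ∀ {N} {p q : Subset N} {x} → x ∈ p ─ q → x ∉ q
  x∈p─q⇒x∉q {p = s ∷ p} {inside  ∷ q} {zero}  ()
  x∈p─q⇒x∉q {p = s ∷ p} {outside ∷ q} {zero}  _             ()
  x∈p─q⇒x∉q {p = s ∷ p} {t ∷ q}       {suc x} (there x∈p─q) (there x∈q) = x∈p─q⇒x∉q x∈p─q x∈q

  x∉p∪⁅y⁆ : ∀ {N} {p : Subset N} {x y} → x ∉ p → x ≢ y → x ∉ p ∪ ⁅ y ⁆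
  x∉p∪⁅y⁆ {p = p} {y = y} x∉p x≢y = [ x∉p , x≢y ∘ x∈⁅y⁆⇒x≡y y ] ∘ x∈p∪q⁻ p ⁅ y ⁆

  p∪⁅x⁆⊆q : ∀ {N} {p q : Subset N} {x} → p ⊆ q → x ∈ q → p ∪ ⁅ x ⁆ ⊆ q
  p∪⁅x⁆⊆q {p = p} {q} {x} p⊆q x∈q =
    [ p⊆q , (λ y∈⁅x⁆ → ≡.subst (_∈ q) (≡.sym (x∈⁅y⁆⇒x≡y x y∈⁅x⁆)) x∈q) ] ∘ x∈p∪q⁻ p ⁅ x ⁆

  ∣p∣≡∣p─q∣+∣q∣ : ∀ {N} {p q : Subset N} → q ⊆ p → ∣ p ∣ ≡ ∣ p ─ q ∣ ℕ.+ ∣ q ∣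
  ∣p∣≡∣p─q∣+∣q∣ {p = []}          {[]}          _   = ≡.refl
  ∣p∣≡∣p─q∣+∣q∣ {p = inside  ∷ p} {inside  ∷ q} q⊆p = ≡.trans (≡.cong suc (∣p∣≡∣p─q∣+∣q∣ (drop-∷-⊆ q⊆p))) (≡.sym (+-suc _ _))
  ∣p∣≡∣p─q∣+∣q∣ {p = inside  ∷ p} {outside ∷ q} q⊆p = ≡.cong suc (∣p∣≡∣p─q∣+∣q∣ (drop-∷-⊆ q⊆p))
  ∣p∣≡∣p─q∣+∣q∣ {p = outside ∷ p} {outside ∷ q} q⊆p = ∣p∣≡∣p─q∣+∣q∣ (drop-∷-⊆ q⊆p)
  ∣p∣≡∣p─q∣+∣q∣ {p = outside ∷ p} {inside  ∷ q} q⊆p with q⊆p here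
  ... | ()

module Sums (F : CommutativeRing 0ℓ 0ℓ) where
  open CommutativeRing F hiding (zero)
  open import Relation.Binary.Reasoning.Setoid setoid
  private module S = Algebra.Properties.Semiring.Sum semiring

  combination : ∀ {d N} → (Fin d → Carrier) → (Fin d → Fin N → Carrier) → Fin N → Carrier
  combination a v p = ∑ F (λ i → a i * v i p)

  ∑≡sum : ∀ {n} (f : Fin n → Carrier) → ∑ F f ≡ S.sum f
  ∑≡sum {zero}  f = ≡.refl
  ∑≡sum {suc n} f = ≡.cong (f zero +_) (∑≡sum (f ∘ suc))

  ∑-cong : ∀ {n} {f g : Fin n → Carrier} → (∀ i → f i ≈ g i) → ∑ F f ≈ ∑ F g
  ∑-cong {f = f} {g} f≈g = ≡.subst₂ _≈_ (≡.sym (∑≡sum f)) (≡.sym (∑≡sum g)) (S.sum-cong-≋ f≈g)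

  ∑-zero : ∀ {n} {f : Fin n → Carrier} → (∀ i → f i ≈ 0#) → ∑ F f ≈ 0#
  ∑-zero {zero}  f≈0 = refl
  ∑-zero {suc n} f≈0 = trans (+-cong (f≈0 zero) (∑-zero (f≈0 ∘ suc))) (+-identityˡ 0#)

  ∑-distrib-+ : ∀ {n} (f g : Fin n → Carrier) → ∑ F (λ i → f i + g i) ≈ ∑ F f + ∑ F g
  ∑-distrib-+ f g =
    ≡.subst₂ _≈_ (≡.sym (∑≡sum (λ i → f i + g i))) (≡.sym (≡.cong₂ _+_ (∑≡sum f) (∑≡sum g))) (S.∑-distrib-+ f g)

  *-distribˡ-∑ : ∀ {n} x (f : Fin n → Carrier) → x * ∑ F f ≈ ∑ F (λ i → x * f i)
  *-distribˡ-∑ x f =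
    ≡.subst₂ _≈_ (≡.cong (x *_) (≡.sym (∑≡sum f))) (≡.sym (∑≡sum (λ i → x * f i))) (S.*-distribˡ-sum x f)

  *-distribʳ-∑ : ∀ {n} x (f : Fin n → Carrier) → ∑ F f * x ≈ ∑ F (λ i → f i * x)
  *-distribʳ-∑ x f =
    ≡.subst₂ _≈_ (≡.cong (_* x) (≡.sym (∑≡sum f))) (≡.sym (∑≡sum (λ i → f i * x))) (S.*-distribʳ-sum x f)

  ∑-comm : ∀ {m n} (f : Fin m → Fin n → Carrier) →
           ∑ F (λ i → ∑ F (λ j → f i j)) ≈ ∑ F (λ j → ∑ F (λ i → f i j))
  ∑-comm f = ≡.subst₂ _≈_ (≡.sym (∑≡∑ f)) (≡.sym (∑≡∑ (λ j i → f i j))) (S.∑-comm f)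
    where
    ∑≡∑ : ∀ {m n} (g : Fin m → Fin n → Carrier) → ∑ F (λ i → ∑ F (g i)) ≡ S.sum (λ i → S.sum (g i))
    ∑≡∑ g = ≡.trans (∑≡sum (λ i → ∑ F (g i))) (S.sum-cong-≗ (λ i → ∑≡sum (g i)))

  ∑-remove : ∀ {n} (i : Fin (suc n)) (f : Fin (suc n) → Carrier) →
             ∑ F f ≈ f i + ∑ F (f ∘ punchIn i)
  ∑-remove i f = ≡.subst₂ _≈_ (≡.sym (∑≡sum f)) (≡.cong (f i +_) (≡.sym (∑≡sum (f ∘ punchIn i))))
                          (S.sum-remove {i = i} f)

  ∑-single : ∀ {n} (i : Fin n) (f : Fin n → Carrier) → (∀ j → j ≢ i → f j ≈ 0#) → ∑ F f ≈ f i
  ∑-single {suc n} i f f≈0 = begin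
    ∑ F f                      ≈⟨ ∑-remove i f ⟩
    f i + ∑ F (f ∘ punchIn i)  ≈⟨ +-congˡ (∑-zero (λ j → f≈0 (punchIn i j) (punchInᵢ≢i i j))) ⟩
    f i + 0#                   ≈⟨ +-identityʳ (f i) ⟩
    f i                        ∎

module FiniteSearch (F : CommutativeRing 0ℓ 0ℓ) {q : ℕ} (size : HasSize F q) where
  open CommutativeRing F hiding (zero)

  private
    element : Fin q → Carrier
    element = proj₁ size

    index : Carrier → Fin q
    index x = proj₁ (proj₂ (proj₂ size) x)

    element-index : ∀ x → element (index x) ≈ x
    element-index x = proj₂ (proj₂ (proj₂ size) x)

    index-injective : ∀ {x y} → index x ≡ index y → x ≈ y
    index-injective {x} {y} ix≡iy =
      trans (sym (element-index x)) (trans (reflexive (≡.cong element ix≡iy)) (element-index y))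

    index-cong : ∀ {x y} → x ≈ y → index x ≡ index y
    index-cong {x} {y} x≈y =
      proj₁ (proj₂ size) _ _ (trans (element-index x) (trans x≈y (sym (element-index y))))

  infix 4 _≈?_
  _≈?_ : Decidable _≈_
  x ≈? y = map′ index-injective index-cong (index x ≟ index y)

  -- Vectors in Carrier^N are enumerated, up to ≈, by Fin (q ^ N).
  ∃? : ∀ {N} {R : (Fin N → Carrier) → Set} → (∀ c → Dec (R c)) →
       (∀ {c c′} → (∀ i → c i ≈ c′ i) → R c → R c′) → Dec (∃ R)
  ∃? {N} {R} R? resp = map′ (λ (k , r) → decode k , r) encode (any? (R? ∘ decode))
    where
    decode : Fin (q ℕ.^ N) → Fin N → Carrier
    decode k i = element (finToFun k i)

    encode : ∃ R → ∃ (R ∘ decode)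
    encode (c , r) = funToFin (index ∘ c) , resp c≈decode r
      where
      c≈decode : ∀ i → c i ≈ decode (funToFin (index ∘ c)) i
      c≈decode i = trans (sym (element-index (c i)))
                         (reflexive (≡.cong element (≡.sym (finToFun-funToFin (index ∘ c) i))))

module Elimination (F : CommutativeRing 0ℓ 0ℓ) (isField : IsField F)
                   (_≈?_ : Decidable (CommutativeRing._≈_ F)) where
  open CommutativeRing F hiding (zero)
  open Sums F
  open import Algebra.Properties.Ring ring using (-‿distribˡ-*)
  open import Relation.Binary.Reasoning.Setoid setoid

  IndepOn : ∀ {d N} → Subset N → (Fin d → Fin N → Carrier) → Set
  IndepOn S v = ∀ a → (∀ p → p ∈ S → combination a v p ≈ 0#) → ∀ i → a i ≈ 0#

  dropColumn₀ : ∀ {d N} → (Fin d → Fin (suc N) → Carrier) → Fin d → Fin N → Carrier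
  dropColumn₀ v i p = v i (suc p)

  IndepOn-dropColumn₀ : ∀ {d N x S} (v : Fin d → Fin (suc N) → Carrier) →
                        (∀ a → zero ∈ x ∷ S → combination a v zero ≈ 0#) →
                        IndepOn (x ∷ S) v → IndepOn S (dropColumn₀ v)
  IndepOn-dropColumn₀ v column₀ indep a hyp = indep a λ
    { zero    z∈xS          → column₀ a z∈xS
    ; (suc p) (there p∈S)   → hyp p p∈S
    }

  rowOp : ∀ {d N} (i₀ : Fin (suc d)) (y : Fin d → Carrier) →
          (Fin (suc d) → Fin N → Carrier) → Fin d → Fin N → Carrier
  rowOp i₀ y v j p = v (punchIn i₀ j) p + y j * v i₀ p

  combination-rowOp : ∀ {d N} i₀ y (v : Fin (suc d) → Fin N → Carrier) a p →
                      combination a (rowOp i₀ y v) p ≈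
                      combination (insertAt a i₀ (∑ F (λ j → a j * y j))) v p
  combination-rowOp {d} i₀ y v a p = begin
    ∑ F (λ j → a j * (v (punchIn i₀ j) p + y j * v i₀ p))
      ≈⟨ ∑-cong (λ j → trans (distribˡ (a j) _ _) (+-congˡ (sym (*-assoc (a j) (y j) (v i₀ p))))) ⟩
    ∑ F (λ j → a j * v (punchIn i₀ j) p + (a j * y j) * v i₀ p)
      ≈⟨ ∑-distrib-+ (λ j → a j * v (punchIn i₀ j) p) (λ j → (a j * y j) * v i₀ p) ⟩
    ∑ F (λ j → a j * v (punchIn i₀ j) p) + ∑ F (λ j → (a j * y j) * v i₀ p)
      ≈⟨ +-comm _ _ ⟩
    ∑ F (λ j → (a j * y j) * v i₀ p) + ∑ F (λ j → a j * v (punchIn i₀ j) p)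
      ≈⟨ +-cong (sym (*-distribʳ-∑ (v i₀ p) (λ j → a j * y j)))
                (∑-cong (λ j → *-congʳ (reflexive (≡.sym (insertAt-punchIn a i₀ β j))))) ⟩
    β * v i₀ p + ∑ F (λ j → a′ (punchIn i₀ j) * v (punchIn i₀ j) p)
      ≈⟨ +-congʳ (*-congʳ (reflexive (insertAt-lookup a i₀ β))) ⟨
    a′ i₀ * v i₀ p + ∑ F (λ j → a′ (punchIn i₀ j) * v (punchIn i₀ j) p)
      ≈⟨ ∑-remove i₀ (λ i → a′ i * v i p) ⟨
    combination a′ v p ∎
    where
    β : Carrier
    β = ∑ F (λ j → a j * y j)
    a′ : Fin (suc d) → Carrier
    a′ = insertAt a i₀ β

  IndepOn-rowOp : ∀ {d N S} i₀ y {v : Fin (suc d) → Fin N → Carrier} →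
                  IndepOn S v → IndepOn S (rowOp i₀ y v)
  IndepOn-rowOp {d} {S = S} i₀ y {v} indep a hyp j = begin
    a j                ≡⟨ insertAt-punchIn a i₀ β j ⟨
    a′ (punchIn i₀ j)  ≈⟨ indep a′ combination≈0 (punchIn i₀ j) ⟩
    0#                 ∎
    where
    β : Carrier
    β = ∑ F (λ j → a j * y j)
    a′ : Fin (suc d) → Carrier
    a′ = insertAt a i₀ β
    combination≈0 : ∀ p → p ∈ S → combination a′ v p ≈ 0#
    combination≈0 p p∈S = trans (sym (combination-rowOp i₀ y v a p)) (hyp p p∈S)

  x-xα*u≈0 : ∀ {u α} → u * α ≈ 1# → ∀ x → x + - (x * α) * u ≈ 0#
  x-xα*u≈0 {u} {α} uα≈1 x = begin
    x + - (x * α) * u    ≈⟨ +-congˡ (-‿distribˡ-* (x * α) u) ⟨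
    x + - ((x * α) * u)  ≈⟨ +-congˡ (-‿cong (trans (*-assoc x α u) (*-congˡ (trans (*-comm α u) uα≈1)))) ⟩
    x + - (x * 1#)       ≈⟨ +-congˡ (-‿cong (*-identityʳ x)) ⟩
    x + - x              ≈⟨ -‿inverseʳ x ⟩
    0#                   ∎

  -- Gaussian elimination: the first column either vanishes on every row and is dropped, or a pivot row
  -- clears it and then both the pivot row and the column are dropped.
  IndepOn⇒≤∣S∣ : ∀ {d N} (S : Subset N) (v : Fin d → Fin N → Carrier) → IndepOn S v → d ≤ ∣ S ∣
  IndepOn⇒≤∣S∣ {zero}          []            v indep = z≤n
  IndepOn⇒≤∣S∣ {suc d}         []            v indep = ⊥-elim (proj₁ isField (sym (indep (λ _ → 1#) (λ ()) zero)))
  IndepOn⇒≤∣S∣                 (outside ∷ S) v indep =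
    IndepOn⇒≤∣S∣ S (dropColumn₀ v) (IndepOn-dropColumn₀ v (λ _ ()) indep)
  IndepOn⇒≤∣S∣ {zero}          (inside ∷ S)  v indep = z≤n
  IndepOn⇒≤∣S∣ {suc d} {suc N} (inside ∷ S)  v indep with any? (λ i → ¬? (v i zero ≈? 0#))
  ... | no noPivot = m≤n⇒m≤1+n (IndepOn⇒≤∣S∣ S (dropColumn₀ v) (IndepOn-dropColumn₀ v column₀≈0 indep))
    where
    v₀≈0 : ∀ i → v i zero ≈ 0#
    v₀≈0 i = decidable-stable (v i zero ≈? 0#) (λ vi≉0 → noPivot (i , vi≉0))
    column₀≈0 : ∀ a → zero ∈ inside ∷ S → combination a v zero ≈ 0#
    column₀≈0 a _ = ∑-zero (λ i → trans (*-congˡ (v₀≈0 i)) (zeroʳ (a i)))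
  ... | yes (i₀ , pivot≉0) with proj₂ isField (v i₀ zero) pivot≉0
  ... | α , pivot*α≈1 =
    s≤s (IndepOn⇒≤∣S∣ S (dropColumn₀ v′) (IndepOn-dropColumn₀ v′ column₀≈0 (IndepOn-rowOp i₀ y {v} indep)))
    where
    y : Fin d → Carrier
    y j = - (v (punchIn i₀ j) zero * α)
    v′ : Fin d → Fin (suc N) → Carrier
    v′ = rowOp i₀ y v
    column₀≈0 : ∀ a → zero ∈ inside ∷ S → combination a v′ zero ≈ 0#
    column₀≈0 a _ = ∑-zero (λ j → trans (*-congˡ (x-xα*u≈0 pivot*α≈1 (v (punchIn i₀ j) zero))) (zeroʳ (a j)))

  *-cancelʳ-≉0 : ∀ a {c} → ¬ c ≈ 0# → a * c ≈ 0# → a ≈ 0#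
  *-cancelʳ-≉0 a {c} c≉0 ac≈0 with proj₂ isField c c≉0
  ... | γ , cγ≈1 = begin
    a              ≈⟨ *-identityʳ a ⟨
    a * 1#         ≈⟨ *-congˡ cγ≈1 ⟨
    a * (c * γ)    ≈⟨ *-assoc a c γ ⟨
    (a * c) * γ    ≈⟨ *-congʳ ac≈0 ⟩
    0# * γ         ≈⟨ zeroˡ γ ⟩
    0#             ∎

  diagonal⇒IndepOn : ∀ {d N S} (v : Fin d → Fin N → Carrier) (π : Fin d → Fin N) → (∀ k → π k ∈ S) →
                     (∀ k → ¬ v k (π k) ≈ 0#) → (∀ k k′ → k′ ≢ k → v k′ (π k) ≈ 0#) → IndepOn S v
  diagonal⇒IndepOn v π π∈S diagonal≉0 offDiagonal≈0 a hyp k = *-cancelʳ-≉0 (a k) (diagonal≉0 k) (begin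
    a k * v k (π k)          ≈⟨ ∑-single k (λ k′ → a k′ * v k′ (π k)) offDiagonalTerm≈0 ⟨
    combination a v (π k)    ≈⟨ hyp (π k) (π∈S k) ⟩
    0#                       ∎)
    where
    offDiagonalTerm≈0 : ∀ k′ → k′ ≢ k → a k′ * v k′ (π k) ≈ 0#
    offDiagonalTerm≈0 k′ k′≢k = trans (*-congˡ (offDiagonal≈0 k k′ k′≢k)) (zeroʳ (a k′))

module ColumnMatroid (F : CommutativeRing 0ℓ 0ℓ) {q : ℕ} (size : HasSize F q) where
  open CommutativeRing F hiding (zero)
  open Sums F
  open FiniteSearch F size
  open SubsetLemmas using (x∉p∪⁅y⁆)

  -- With these, ColIndep F A Y unfolds to ∀ c → SupportedIn Y c → InKernel A c → ∀ p → c p ≈ 0#.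
  SupportedIn : ∀ {N} → Subset N → (Fin N → Carrier) → Set
  SupportedIn Z c = ∀ p → p ∉ Z → c p ≈ 0#

  InKernel : ∀ {m N} → (Fin m → Fin N → Carrier) → (Fin N → Carrier) → Set
  InKernel A c = ∀ j → ∑ F (λ p → c p * A j p) ≈ 0#

  NontrivialDependency : ∀ {m N} → (Fin m → Fin N → Carrier) → Subset N → (Fin N → Carrier) → Set
  NontrivialDependency A Z c = SupportedIn Z c × InKernel A c × ∃ λ p → ¬ c p ≈ 0#

  ¬ColIndep⇒dependency : ∀ {m N} (A : Fin m → Fin N → Carrier) Z →
                         ¬ ColIndep F A Z → ∃ (NontrivialDependency A Z)
  ¬ColIndep⇒dependency A Z dependent with ∃? dependency? respects
    where
    dependency? : ∀ c → Dec (NontrivialDependency A Z c)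
    dependency? c = all? (λ p → ¬? (p ∈? Z) →-dec c p ≈? 0#)
              ×-dec all? (λ j → ∑ F (λ p → c p * A j p) ≈? 0#)
              ×-dec any? (λ p → ¬? (c p ≈? 0#))

    respects : ∀ {c c′} → (∀ p → c p ≈ c′ p) → NontrivialDependency A Z c → NontrivialDependency A Z c′
    respects c≈c′ (supported , inKernel , p , cp≉0) =
      (λ p p∉Z → trans (sym (c≈c′ p)) (supported p p∉Z)) ,
      (λ j → trans (∑-cong (λ p → *-congʳ (sym (c≈c′ p)))) (inKernel j)) ,
      p , (λ c′p≈0 → cp≉0 (trans (c≈c′ p) c′p≈0))
  ... | yes dependency = dependency
  ... | no  none       = ⊥-elim (dependent λ c supported inKernel p →
                           decidable-stable (c p ≈? 0#) (λ cp≉0 → none (c , supported , inKernel , p , cp≉0)))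

  dependency-through : ∀ {m N} (A : Fin m → Fin N → Carrier) {Y p} → ColIndep F A Y →
                       ¬ ColIndep F A (Y ∪ ⁅ p ⁆) →
                       ∃ λ c → SupportedIn (Y ∪ ⁅ p ⁆) c × InKernel A c × ¬ c p ≈ 0#
  dependency-through A {Y} {p} indepY dependent with ¬ColIndep⇒dependency A (Y ∪ ⁅ p ⁆) dependent
  ... | c , supported , inKernel , p′ , cp′≉0 =
    c , supported , inKernel , λ cp≈0 → cp′≉0 (indepY c (supportedInY cp≈0) inKernel p′)
    where
    supportedInY : c p ≈ 0# → SupportedIn Y c
    supportedInY cp≈0 p″ p″∉Y with p″ ≟ p
    ... | yes ≡.refl = cp≈0
    ... | no  p″≢p  = supported p″ (x∉p∪⁅y⁆ p″∉Y p″≢p)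

module Quadrics (F : CommutativeRing 0ℓ 0ℓ) where
  open CommutativeRing F hiding (zero)
  open Sums F
  open import Algebra.Properties.CommutativeSemigroup *-commutativeSemigroup using (interchange; x∙yz≈y∙xz)
  open import Relation.Binary.Reasoning.Setoid setoid

  evalQ-combination : ∀ {d} a (w : Fin d → Quadric F) v →
                      ∑ F (λ k → a k * evalQ F (w k) v) ≈ evalQ F (combination a w) v
  evalQ-combination a w v = begin
    ∑ F (λ k → a k * ∑ F (λ m → w k m * monomial F m v))
      ≈⟨ ∑-cong (λ k → *-distribˡ-∑ (a k) (λ m → w k m * monomial F m v)) ⟩
    ∑ F (λ k → ∑ F (λ m → a k * (w k m * monomial F m v)))
      ≈⟨ ∑-comm (λ k m → a k * (w k m * monomial F m v)) ⟩
    ∑ F (λ m → ∑ F (λ k → a k * (w k m * monomial F m v)))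
      ≈⟨ ∑-cong (λ m → ∑-cong (λ k → *-assoc (a k) (w k m) (monomial F m v))) ⟨
    ∑ F (λ m → ∑ F (λ k → (a k * w k m) * monomial F m v))
      ≈⟨ ∑-cong (λ m → *-distribʳ-∑ (monomial F m v) (λ k → a k * w k m)) ⟨
    evalQ F (combination a w) v ∎

  evalQ-zero : ∀ (f : Quadric F) v → (∀ m → f m ≈ 0#) → evalQ F f v ≈ 0#
  evalQ-zero f v f≈0 = ∑-zero (λ m → trans (*-congʳ (f≈0 m)) (zeroˡ (monomial F m v)))

  monomial-homogeneous : ∀ {v w : F³ F} {c} → (∀ i → v i ≈ c * w i) →
                         ∀ m → monomial F m v ≈ (c * c) * monomial F m w
  monomial-homogeneous {v} {w} {c} v≈cw = λ
    { zero                                → scale (# 0) (# 0)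
    ; (suc zero)                          → scale (# 0) (# 1)
    ; (suc (suc zero))                    → scale (# 0) (# 2)
    ; (suc (suc (suc zero)))              → scale (# 1) (# 1)
    ; (suc (suc (suc (suc zero))))        → scale (# 1) (# 2)
    ; (suc (suc (suc (suc (suc zero)))))  → scale (# 2) (# 2)
    }
    where
    scale : ∀ i j → v i * v j ≈ (c * c) * (w i * w j)
    scale i j = trans (*-cong (v≈cw i) (v≈cw j)) (interchange c (w i) c (w j))

  evalQ-homogeneous : ∀ (f : Quadric F) {v w : F³ F} {c} → (∀ i → v i ≈ c * w i) →
                      evalQ F f v ≈ (c * c) * evalQ F f w
  evalQ-homogeneous f {v} {w} {c} v≈cw = begin
    ∑ F (λ m → f m * monomial F m v)            ≈⟨ ∑-cong (λ m → *-congˡ {f m} (monomial-homogeneous v≈cw m)) ⟩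
    ∑ F (λ m → f m * ((c * c) * monomial F m w)) ≈⟨ ∑-cong (λ m → x∙yz≈y∙xz (f m) (c * c) (monomial F m w)) ⟩
    ∑ F (λ m → (c * c) * (f m * monomial F m w)) ≈⟨ *-distribˡ-∑ (c * c) (λ m → f m * monomial F m w) ⟨
    (c * c) * evalQ F f w                        ∎

  point : Carrier → Carrier → Carrier → F³ F
  point x y z zero             = x
  point x y z (suc zero)       = y
  point x y z (suc (suc zero)) = z

  vanishing⇒zero : ¬ 0# ≈ 1# → ∀ (f : Quadric F) → (∀ v → NonZero³ F v → evalQ F f v ≈ 0#) → ∀ m → f m ≈ 0#
  vanishing⇒zero 0≉1 f vanishes = λ
    { zero                                → f₀≈0
    ; (suc zero)                          → f₁≈0
    ; (suc (suc zero))                    → f₂≈0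
    ; (suc (suc (suc zero)))              → f₃≈0
    ; (suc (suc (suc (suc zero))))        → f₄≈0
    ; (suc (suc (suc (suc (suc zero)))))  → f₅≈0
    }
    where
    -- evalQ at a point is read off one monomial term at a time:
    -- t ▸ rest drops a vanishing term t, t ◂ rest keeps t when all later terms vanish.
    infixr 5 _▸_ _◂_
    _▸_ : ∀ {a b c} → a ≈ 0# → b ≈ c → a + b ≈ c
    a≈0 ▸ b≈c = trans (+-cong a≈0 b≈c) (+-identityˡ _)

    _◂_ : ∀ {a b c} → a ≈ c → b ≈ 0# → a + b ≈ c
    a≈c ◂ b≈0 = trans (+-cong a≈c b≈0) (+-identityʳ _)

    0ʳ : ∀ {a x} → a * (x * 0#) ≈ 0#
    0ʳ {a} {x} = trans (*-congˡ (zeroʳ x)) (zeroʳ a)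

    0ˡ : ∀ {a x} → a * (0# * x) ≈ 0#
    0ˡ {a} {x} = trans (*-congˡ (zeroˡ x)) (zeroʳ a)

    1· : ∀ {a} → a * (1# * 1#) ≈ a
    1· {a} = trans (*-congˡ (*-identityˡ 1#)) (*-identityʳ a)

    known : ∀ {a t} → a ≈ 0# → a * t ≈ 0#
    known {a} {t} a≈0 = trans (*-congʳ a≈0) (zeroˡ t)

    at : ∀ {m} v → NonZero³ F v → evalQ F f v ≈ f m → f m ≈ 0#
    at v v≢0 value≈fm = trans (sym value≈fm) (vanishes v v≢0)

    x≢0 : ∀ {y z} → NonZero³ F (point 1# y z)
    x≢0 all≈0 = 0≉1 (sym (all≈0 zero))

    y≢0 : ∀ {z} → NonZero³ F (point 0# 1# z)
    y≢0 all≈0 = 0≉1 (sym (all≈0 (suc zero)))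

    z≢0 : NonZero³ F (point 0# 0# 1#)
    z≢0 all≈0 = 0≉1 (sym (all≈0 (suc (suc zero))))

    f₀≈0 : f (# 0) ≈ 0#
    f₀≈0 = at (point 1# 0# 0#) x≢0 (1· ◂ 0ʳ ▸ 0ʳ ▸ 0ʳ ▸ 0ʳ ▸ 0ʳ ▸ refl)
    f₃≈0 : f (# 3) ≈ 0#
    f₃≈0 = at (point 0# 1# 0#) y≢0 (0ʳ ▸ 0ˡ ▸ 0ʳ ▸ 1· ◂ 0ʳ ▸ 0ʳ ▸ refl)
    f₅≈0 : f (# 5) ≈ 0#
    f₅≈0 = at (point 0# 0# 1#) z≢0 (0ʳ ▸ 0ʳ ▸ 0ˡ ▸ 0ʳ ▸ 0ˡ ▸ 1· ◂ refl)
    f₁≈0 : f (# 1) ≈ 0#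
    f₁≈0 = at (point 1# 1# 0#) x≢0 (known f₀≈0 ▸ 1· ◂ 0ʳ ▸ known f₃≈0 ▸ 0ʳ ▸ 0ʳ ▸ refl)
    f₂≈0 : f (# 2) ≈ 0#
    f₂≈0 = at (point 1# 0# 1#) x≢0 (known f₀≈0 ▸ 0ʳ ▸ 1· ◂ 0ʳ ▸ 0ˡ ▸ known f₅≈0 ▸ refl)
    f₄≈0 : f (# 4) ≈ 0#
    f₄≈0 = at (point 0# 1# 1#) y≢0 (0ʳ ▸ 0ˡ ▸ 0ˡ ▸ known f₃≈0 ▸ 1· ◂ known f₅≈0 ▸ refl)

module Veronese (F : CommutativeRing 0ℓ 0ℓ) (isField : IsField F) {q} (size : HasSize F q)
                {N} (rep : Fin N → F³ F) (points : IsPointList F rep)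
                (H : Fin (N ℕ.∸ 6) → Fin N → CommutativeRing.Carrier F)
                (parityCheck : IsParityCheck F (veroneseGen F rep) H) where
  open CommutativeRing F hiding (zero)
  open Sums F
  open FiniteSearch F size
  open Elimination F isField _≈?_
  open ColumnMatroid F size
  open Quadrics F
  open SubsetLemmas
  open import Data.Fin.Subset using (_⊆_; _⊂_; _─_)
  open import Data.Fin.Subset.Properties using (x∈p∧x∉q⇒x∈p─q; p─q⊆p; p⊆p∪q; x∈p∪q⁺; x∈⁅x⁆; p⊂q⇒∣p∣<∣q∣)
  open import Data.Nat.Properties using (<⇒≱)
  open import Data.Sum using (inj₂)

  evaluation : Quadric F → Fin N → Carrier
  evaluation f p = evalQ F f (rep p)

  evaluation-combination : ∀ {d} a (w : Fin d → Quadric F) p →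
                           combination a (evaluation ∘ w) p ≈ evaluation (combination a w) p
  evaluation-combination a w p = evalQ-combination a w (rep p)

  evaluation-injective : ∀ f → (∀ p → evaluation f p ≈ 0#) → ∀ m → f m ≈ 0#
  evaluation-injective f f≈0 = vanishing⇒zero (proj₁ isField) f vanishesOnNonzero
    where
    vanishesOnNonzero : ∀ v → NonZero³ F v → evalQ F f v ≈ 0#
    vanishesOnNonzero v v≢0 with proj₂ (proj₂ points) v v≢0
    ... | p , c , v≈c·rep = trans (evalQ-homogeneous f v≈c·rep) (trans (*-congˡ (f≈0 p)) (zeroʳ (c * c)))

  evaluation∈kernel : ∀ f → InKernel H (evaluation f)
  evaluation∈kernel f j =
    trans (∑-cong (λ p → *-comm (evaluation f p) (H j p))) (proj₂ (parityCheck (evaluation f)) (f , λ p → refl) j)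

  kernel⊆evaluations : ∀ {c} → InKernel H c → ∃ λ f → ∀ p → c p ≈ evaluation f p
  kernel⊆evaluations {c} c∈kernel =
    proj₁ (parityCheck c) (λ j → trans (∑-cong (λ p → *-comm (H j p) (c p))) (c∈kernel j))

  IndepOn⇒QIndep : ∀ {d S} (w : Fin d → Quadric F) → IndepOn S (evaluation ∘ w) → QIndep F w
  IndepOn⇒QIndep w indep a combination≈0 =
    indep a (λ p _ → trans (evaluation-combination a w p) (evalQ-zero (combination a w) (rep p) combination≈0))

  -- A combination of the w k vanishing on X ─ Y is the evaluation of a quadric supported in the
  -- independent set Y, hence zero.
  dim≤∣X─Y∣ : ∀ {d} X {Y} → ColIndep F H Y → (w : Fin d → Quadric F) →
              (∀ k → VanishOffX F rep X (w k)) → QIndep F w → d ≤ ∣ X ─ Y ∣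
  dim≤∣X─Y∣ X {Y} indepY w vanishOffX independent = IndepOn⇒≤∣S∣ (X ─ Y) (evaluation ∘ w) indepOn
    where
    indepOn : IndepOn (X ─ Y) (evaluation ∘ w)
    indepOn a hyp =
      independent a (evaluation-injective f (indepY (evaluation f) supportedInY (evaluation∈kernel f)))
      where
      f : Quadric F
      f = combination a w
      supportedInY : SupportedIn Y (evaluation f)
      supportedInY p p∉Y with p ∈? X
      ... | yes p∈X = trans (sym (evaluation-combination a w p)) (hyp p (x∈p∧x∉q⇒x∈p─q p∈X p∉Y))
      ... | no  p∉X = trans (sym (evaluation-combination a w p))
                            (∑-zero (λ k → trans (*-congˡ (vanishOffX k p p∉X)) (zeroʳ (a k))))

  module MaximalIndependent {X Y} (Y⊆X : Y ⊆ X) (indepY : ColIndep F H Y)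
                            (maximal : ∀ Z → Z ⊆ X → ColIndep F H Z → ∣ Z ∣ ≤ ∣ Y ∣) where

    Y∪⁅p⁆⊆X : ∀ {p} → p ∈ X ─ Y → Y ∪ ⁅ p ⁆ ⊆ X
    Y∪⁅p⁆⊆X p∈X─Y = p∪⁅x⁆⊆q Y⊆X (p─q⊆p X Y p∈X─Y)

    Y∪⁅p⁆-dependent : ∀ {p} → p ∈ X ─ Y → ¬ ColIndep F H (Y ∪ ⁅ p ⁆)
    Y∪⁅p⁆-dependent {p} p∈X─Y indep =
      <⇒≱ (p⊂q⇒∣p∣<∣q∣ Y⊂Y∪⁅p⁆) (maximal (Y ∪ ⁅ p ⁆) (Y∪⁅p⁆⊆X p∈X─Y) indep)
      where
      Y⊂Y∪⁅p⁆ : Y ⊂ Y ∪ ⁅ p ⁆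
      Y⊂Y∪⁅p⁆ = p⊆p∪q ⁅ p ⁆ , p , x∈p∪q⁺ (inj₂ (x∈⁅x⁆ p)) , x∈p─q⇒x∉q p∈X─Y

    quadricThrough : ∀ {p} → p ∈ X ─ Y →
                     ∃ λ f → SupportedIn (Y ∪ ⁅ p ⁆) (evaluation f) × ¬ evaluation f p ≈ 0#
    quadricThrough {p} p∈X─Y with dependency-through H indepY (Y∪⁅p⁆-dependent p∈X─Y)
    ... | c , supported , c∈kernel , cp≉0 with kernel⊆evaluations c∈kernel
    ...   | f , c≈f =
      f , (λ p′ p′∉ → trans (sym (c≈f p′)) (supported p′ p′∉)) , (λ fp≈0 → cp≉0 (trans (c≈f p) fp≈0))

    -- The quadric through p ∈ X ─ Y is nonzero at p and zero at every other point of X ─ Y.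
    ∣X─Y∣≤dim : ∀ {d} → (∀ e (w : Fin e → Quadric F) → (∀ k → VanishOffX F rep X (w k)) → QIndep F w → e ≤ d) →
                ∣ X ─ Y ∣ ≤ d
    ∣X─Y∣≤dim dimMaximal = dimMaximal ∣ X ─ Y ∣ w vanishOffX
      (IndepOn⇒QIndep w (diagonal⇒IndepOn (evaluation ∘ w) π π∈X─Y diagonal offDiagonal))
      where
      π : Fin ∣ X ─ Y ∣ → Fin N
      π = members (X ─ Y)
      π∈X─Y : ∀ k → π k ∈ X ─ Y
      π∈X─Y = members-∈ (X ─ Y)
      w : Fin ∣ X ─ Y ∣ → Quadric F
      w k = proj₁ (quadricThrough (π∈X─Y k))
      supported : ∀ k → SupportedIn (Y ∪ ⁅ π k ⁆) (evaluation (w k))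
      supported k = proj₁ (proj₂ (quadricThrough (π∈X─Y k)))
      diagonal : ∀ k → ¬ evaluation (w k) (π k) ≈ 0#
      diagonal k = proj₂ (proj₂ (quadricThrough (π∈X─Y k)))
      vanishOffX : ∀ k → VanishOffX F rep X (w k)
      vanishOffX k p p∉X = supported k p (p∉X ∘ Y∪⁅p⁆⊆X (π∈X─Y k))
      offDiagonal : ∀ k k′ → k′ ≢ k → evaluation (w k′) (π k) ≈ 0#
      offDiagonal k k′ k′≢k =
        supported k′ (π k) (x∉p∪⁅y⁆ (x∈p─q⇒x∉q (π∈X─Y k)) (k′≢k ∘ members-injective (X ─ Y) ∘ ≡.sym))

lemma3p3 : (q : ℕ) → IsPrimePower q → 4 ≤ q →
    (F : CommutativeRing 0ℓ 0ℓ) → IsField F → HasSize F q →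
    (rep : Fin (numPoints q) → F³ F) → IsPointList F rep →
    (H : Fin (numPoints q Data.Nat.∸ 6) → Fin (numPoints q) → CommutativeRing.Carrier F) →
    IsParityCheck F (veroneseGen F rep) H →
    (X : Subset (numPoints q)) (n d : ℕ) →
    IsNullity F H X n → IsDim F (VanishOffX F rep X) d → n ≡ d
lemma3p3 q _ _ F isField size rep points H parityCheck X n d
         (_ , ((Y , Y⊆X , indepY , ≡.refl) , maximal) , ≡.refl) ((w , vanishOffX , independent) , dimMaximal) =
  begin
    ∣ X ∣ ∸ ∣ Y ∣              ≡⟨ ≡.cong (_∸ ∣ Y ∣) (∣p∣≡∣p─q∣+∣q∣ Y⊆X) ⟩
    ∣ X ─ Y ∣ + ∣ Y ∣ ∸ ∣ Y ∣  ≡⟨ m+n∸n≡m ∣ X ─ Y ∣ ∣ Y ∣ ⟩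
    ∣ X ─ Y ∣                  ≡⟨ ≤-antisym (∣X─Y∣≤dim dimMaximal) (dim≤∣X─Y∣ X indepY w vanishOffX independent) ⟩
    d                          ∎
  where
  open ≡.≡-Reasoning
  open Data.Nat using (_+_; _∸_)
  open Data.Nat.Properties using (m+n∸n≡m; ≤-antisym)
  open Data.Fin.Subset using (_─_)
  open SubsetLemmas using (∣p∣≡∣p─q∣+∣q∣)
  open Veronese F isField size rep points H parityCheck
  open MaximalIndependent Y⊆X indepY maximal
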